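{- Let $D=(\mathcal{S}_D,\mathcal{P}_D)$ be an abstract storage device (ASD). Then: (i) $D$ is state-minimal if and only if for every pair of distinct states $s,s'\in\mathcal{S}_D$ there exists $\pi\in\mathcal{P}_D$ such that $s$ and $s'$ lie in different blocks of $\pi$; and this holds if and only if $\bigwedge_{\pi\in\mathcal{P}_D}\pi=\mathrm{id}_{\mathcal{S}_D}$. (ii) $D$ is partition-minimal if and only if $\mathcal{P}_D$ is an antichain with respect to refinement $\preceq$. (iii) For every ASD $D$ there exists a minimal ASD $D'$ with $D'\equiv D$.
   Context: An abstract storage device (ASD) is a pair $D=(\mathcal{S}_D,\mathcal{P}_D)$ where $\mathcal{S}_D$ is a finite set (the state space) and $\mathcal{P}_D$ is a finite family of set partitions of $\mathcal{S}_D$ (the partition set). For partitions $\pi,\pi'$ of a set $\mathcal{S}$, $\pi\preceq\pi'$ ($\pi$ refines $\pi'$) means every block of $\pi$ is contained in some block of $\pi'$; $\wedge$ denotes the meet (the partition into nonempty intersections of blocks), and $\mathrm{id}_{\mathcal{S}}=\{\{s\}: s\in\mathcal{S}\}$. A set of partitions is an antichain if no two distinct members are comparable under $\preceq$. For a function $\phi:\mathcal{S}\to\mathcal{S}'$ and a partition $\pi$ of $\mathcal{S}'$, $\pi\circ\phi$ is the partition of $\mathcal{S}$ in which $x,y$ are in the same block iff $\phi(x),\phi(y)$ are in the same block of $\pi$. An ASD $D$ is reducible to $D'$, written $D\le D'$, if there exist functions $\phi:\mathcal{S}_D\to\mathcal{S}_{D'}$ and $\alpha:\mathcal{P}_D\to\mathcal{P}_{D'}$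 with $\alpha(\pi)\circ\phi\preceq\pi$ for all $\pi\in\mathcal{P}_D$. $D\equiv D'$ means $D\le D'$ and $D'\le D$. $D$ is state-minimal if there is no $D'\equiv D$ with $|\mathcal{S}_{D'}|<|\mathcal{S}_D|$, partition-minimal if there is no $D'\equiv D$ with $|\mathcal{P}_{D'}|<|\mathcal{P}_D|$, and minimal if it is both. -}

module Defs where

open import Level using (0ℓ)
open import Data.Nat using (ℕ; _<_)
open import Data.Fin using (Fin)
open import Data.Product using (Σ; _×_; _,_)
open import Relation.Binary.Core using (Rel)
open import Relation.Binary.Structures using (IsDecEquivalence)
open import Relation.Binary.PropositionalEquality using (_≡_; _≢_)
open import Relation.Nullary using (¬_)

-- Set partitions of the finite set Fin n, given by their
-- (decidable) "same block" equivalence relation.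

record Partition (n : ℕ) : Set₁ where
  field
    _∼_      : Rel (Fin n) 0ℓ
    isDecEqv : IsDecEquivalence _∼_

open Partition public

_⪯_ : ∀ {n} → Partition n → Partition n → Set
_⪯_ {n} π π' = ∀ (x y : Fin n) → _∼_ π x y → _∼_ π' x y

_≐_ : ∀ {n} → Partition n → Partition n → Set
π ≐ π' = (π ⪯ π') × (π' ⪯ π)

-- Abstract storage devices: state space Fin states, partition set
-- given as a family of `parts` pairwise distinct partitions.

record ASD : Set₁ where
  field
    states   : ℕ
    parts    : ℕ
    P        : Fin parts → Partition states
    distinct : ∀ (i j : Fin parts) → i ≢ j → ¬ (P i ≐ P j)

open ASD public

_≤ᴬ_ : ASD → ASD → Set
D ≤ᴬ D' =
  Σ (Fin (states D) → Fin (states D')) λ φ →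
  Σ (Fin (parts D) → Fin (parts D')) λ α →
    ∀ (i : Fin (parts D)) (x y : Fin (states D)) →
      _∼_ (P D' (α i)) (φ x) (φ y) → _∼_ (P D i) x y

_≡ᴬ_ : ASD → ASD → Set
D ≡ᴬ D' = (D ≤ᴬ D') × (D' ≤ᴬ D)

StateMinimal : ASD → Set₁
StateMinimal D = ¬ (Σ ASD λ D' → (D' ≡ᴬ D) × (states D' < states D))

PartitionMinimal : ASD → Set₁
PartitionMinimal D = ¬ (Σ ASD λ D' → (D' ≡ᴬ D) × (parts D' < parts D))

Minimal : ASD → Set₁
Minimal D = StateMinimal D × PartitionMinimal D

meet : (D : ASD) → Partition (states D)
meet D = record
  { _∼_ = λ x y → ∀ (i : Fin (parts D)) → _∼_ (P D i) x y
  ; isDecEqv = record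
    { isEquivalence = record
      { refl  = λ i → IsDecEquivalence.refl (isDecEqv (P D i))
      ; sym   = λ p i → IsDecEquivalence.sym (isDecEqv (P D i)) (p i)
      ; trans = λ p q i → IsDecEquivalence.trans (isDecEqv (P D i)) (p i) (q i)
      }
    ; _≟_ = λ x y → all? (λ i → IsDecEquivalence._≟_ (isDecEqv (P D i)) x y)
    }
  }
  where open import Data.Fin.Properties using (all?)

idPart : (n : ℕ) → Partition n
idPart n = record
  { _∼_ = _≡_
  ; isDecEqv = Relation.Binary.PropositionalEquality.isDecEquivalence Data.Fin._≟_
  }
  where import Relation.Binary.PropositionalEquality
        import Data.Fin

Separating : ASD → Set
Separating D = ∀ (s s' : Fin (states D)) → s ≢ s' →
  Σ (Fin (parts D)) λ i → ¬ (_∼_ (P D i) s s')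

Antichain : ASD → Set
Antichain D = ∀ (i j : Fin (parts D)) → i ≢ j → ¬ (P D i ⪯ P D j)

module Submission where

-- Everything rests on two reduction steps that produce an equivalent
-- device:
--   * a partition that is refined by another one can be dropped
--     ('dropRefined'), and
--   * two states that no partition separates can be merged
--     ('mergeStates'); merging keeps an antichain an antichain.
-- (i)  A non-separating device is not state-minimal by merging; a
--      separating device is state-minimal by pigeonhole, since a state
--      map into fewer states identifies two states that some partition
--      separates.  Conversely, a reduction to fewer partitions composes to
--      a self-reduction (θ , γ) of D whose partition map γ is not
--      injective.  A common power (τ , δ) of it with both τ and δ
--      idempotent exists; for a fixed point c of δ the partition P c
--      refines every P a with δ a ≡ c, which in an antichain forces γ to
--      be injective.
-- (iii) Dropping until an antichain is reached and then merging until the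
--      device separates, by well-founded descent, yields an equivalent
--      device that is minimal by (i) and (ii).

open import Defs
open import Data.Product using (Σ; _×_; _,_; proj₁; proj₂)
open import Data.Sum using (_⊎_; inj₁; inj₂)
open import Data.Unit using (⊤; tt)
open import Data.Nat using (ℕ; zero; suc; _+_; _*_; _∸_; _≤_; _<_; _!; z≤n; s≤s)
open import Data.Nat.Properties
  using (≤-refl; ≤-trans; n≤1+n; m≤m+n; m≤n+m; 1≤n!; m+[n∸m]≡n; m∸n≤m; m<n⇒0<n∸m;
         +-assoc; +-comm; _!≢0)
open import Data.Nat.Divisibility using (_∣_; divides; m∣m*n; ∣-trans; m≤n⇒m!∣n!; ∣⇒≤)
open import Data.Nat.GeneralisedArithmetic using (iterate)
open import Data.Nat.Induction using (<-wellFounded)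
open import Induction.WellFounded using (Acc; acc)
open import Data.Fin using (Fin; toℕ; punchIn; punchOut) renaming (_≟_ to _≟ᶠ_)
open import Data.Fin.Properties
  using (pigeonhole; punchIn-punchOut; punchIn-injective; any?; all?; ¬∀⟶∃¬;
         <⇒≢; toℕ≤pred[n])
open import Relation.Binary.PropositionalEquality
  using (_≡_; _≢_; refl; sym; trans; cong; module ≡-Reasoning)
open import Relation.Binary.Structures using (IsDecEquivalence)
open import Relation.Nullary using (¬_; Dec; yes; no)
open import Relation.Nullary.Decidable using (¬?; _×-dec_; _→-dec_)
open import Function.Bundles using (_⇔_; mk⇔)

module _ {n : ℕ} (π : Partition n) where
  ∼-refl : ∀ {x} → _∼_ π x x
  ∼-refl = IsDecEquivalence.refl (isDecEqv π)

  ∼-sym : ∀ {x y} → _∼_ π x y → _∼_ π y x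
  ∼-sym = IsDecEquivalence.sym (isDecEqv π)

  ∼-trans : ∀ {x y z} → _∼_ π x y → _∼_ π y z → _∼_ π x z
  ∼-trans = IsDecEquivalence.trans (isDecEqv π)

  ∼-dec : ∀ x y → Dec (_∼_ π x y)
  ∼-dec = IsDecEquivalence._≟_ (isDecEqv π)

∼-subst : ∀ {n p} (Q : Fin p → Partition n) {k l x y x' y'} →
  k ≡ l → x ≡ x' → y ≡ y' → _∼_ (Q k) x y → _∼_ (Q l) x' y'
∼-subst Q refl refl refl q = q

⪯-dec : ∀ {n} (π π' : Partition n) → Dec (π ⪯ π')
⪯-dec π π' = all? λ x → all? λ y → ∼-dec π x y →-dec ∼-dec π' x y

pullback : ∀ {m n} → (Fin m → Fin n) → Partition n → Partition m
pullback f π = record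
  { _∼_ = λ a b → _∼_ π (f a) (f b)
  ; isDecEqv = record
    { isEquivalence = record { refl = ∼-refl π ; sym = ∼-sym π ; trans = ∼-trans π }
    ; _≟_ = λ a b → ∼-dec π (f a) (f b)
    }
  }

Reduction : (D D' : ASD) → (Fin (states D) → Fin (states D')) →
  (Fin (parts D) → Fin (parts D')) → Set
Reduction D D' φ α =
  ∀ i x y → _∼_ (P D' (α i)) (φ x) (φ y) → _∼_ (P D i) x y

reduction-∘ : ∀ {D₁ D₂ D₃ φ α ψ β} →
  Reduction D₁ D₂ φ α → Reduction D₂ D₃ ψ β →
  Reduction D₁ D₃ (λ x → ψ (φ x)) (λ i → β (α i))
reduction-∘ {φ = φ} {α} h₁ h₂ i x y q = h₁ i x y (h₂ (α i) (φ x) (φ y) q)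

≤ᴬ-refl : ∀ D → D ≤ᴬ D
≤ᴬ-refl D = (λ x → x) , (λ i → i) , (λ i x y q → q)

≤ᴬ-trans : ∀ {D₁ D₂ D₃} → D₁ ≤ᴬ D₂ → D₂ ≤ᴬ D₃ → D₁ ≤ᴬ D₃
≤ᴬ-trans {D₁} {D₂} {D₃} (φ , α , h₁) (ψ , β , h₂) =
  _ , _ , reduction-∘ {D₁} {D₂} {D₃} h₁ h₂

≡ᴬ-refl : ∀ D → D ≡ᴬ D
≡ᴬ-refl D = ≤ᴬ-refl D , ≤ᴬ-refl D

≡ᴬ-trans : ∀ {D₁ D₂ D₃} → D₁ ≡ᴬ D₂ → D₂ ≡ᴬ D₃ → D₁ ≡ᴬ D₃
≡ᴬ-trans {D₁} {D₂} {D₃} (r₁₂ , r₂₁) (r₂₃ , r₃₂) =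
  ≤ᴬ-trans {D₁} {D₂} {D₃} r₁₂ r₂₃ , ≤ᴬ-trans {D₃} {D₂} {D₁} r₃₂ r₂₁

Shrinking : (ASD → ℕ) → ASD → Set₁
Shrinking size D = Σ ASD λ D' → (D' ≡ᴬ D) × (size D' < size D)

-- If P i refines P j for i ≢ j, then P j is redundant: removing it gives
-- an equivalent device, where P j is simulated by P i.
dropRefined : (D : ASD) (i j : Fin (parts D)) → i ≢ j → P D i ⪯ P D j →
  Shrinking parts D
dropRefined record { parts = zero } () j i≢j i⪯j
dropRefined D@record { states = n ; parts = suc p ; P = Q ; distinct = dist }
            i j i≢j i⪯j = D' , (into , back) , ≤-refl
  where
  D' : ASD
  D' = record
    { states = n ; parts = p ; P = λ k → Q (punchIn j k)
    ; distinct = λ k l k≢l → dist (punchIn j k) (punchIn j l)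
                               (λ e → k≢l (punchIn-injective j k l e)) }

  into : D' ≤ᴬ D
  into = (λ x → x) , punchIn j , (λ k x y q → q)

  survivor : (a : Fin (suc p)) → Σ (Fin p) λ k → Q (punchIn j k) ⪯ Q a
  survivor a with a ≟ᶠ j
  ... | yes refl = punchOut j≢i ,
        λ x y q → i⪯j x y (∼-subst Q (punchIn-punchOut j≢i) refl refl q)
    where j≢i = λ e → i≢j (sym e)
  ... | no a≢j = punchOut j≢a ,
        λ x y → ∼-subst Q (punchIn-punchOut j≢a) refl refl
    where j≢a = λ e → a≢j (sym e)

  back : D ≤ᴬ D'
  back = (λ x → x) , (λ a → proj₁ (survivor a)) , (λ a → proj₂ (survivor a))

-- States s ≢ s' lying in a common block of every Q k are merged by
-- redirecting s' to s and deleting s' from the state space.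
module Merge {m p : ℕ} (Q : Fin p → Partition (suc m))
             (s s' : Fin (suc m)) (s≢s' : s ≢ s') (together : ∀ k → _∼_ (Q k) s s')
             where

  representative : ∀ x → Σ (Fin (suc m)) λ y → (y ≢ s') × (∀ k → _∼_ (Q k) y x)
  representative x with x ≟ᶠ s'
  ... | yes refl = s , s≢s' , together
  ... | no x≢s' = x , x≢s' , (λ k → ∼-refl (Q k))

  rep : Fin (suc m) → Fin (suc m)
  rep x = proj₁ (representative x)

  rep∼ : ∀ k x → _∼_ (Q k) (rep x) x
  rep∼ k x = proj₂ (proj₂ (representative x)) k

  collapse : Fin (suc m) → Fin m
  collapse x = punchOut (λ e → proj₁ (proj₂ (representative x)) (sym e))

  embed : Fin m → Fin (suc m)
  embed = punchIn s'

  embed-collapse : ∀ x → embed (collapse x) ≡ rep x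
  embed-collapse x = punchIn-punchOut _

  Q' : Fin p → Partition m
  Q' k = pullback embed (Q k)

  collapse-reflects : ∀ k x y → _∼_ (Q' k) (collapse x) (collapse y) → _∼_ (Q k) x y
  collapse-reflects k x y q =
    ∼-trans (Q k) (∼-sym (Q k) (rep∼ k x))
      (∼-trans (Q k) (∼-subst Q refl (embed-collapse x) (embed-collapse y) q) (rep∼ k y))

  collapse-preserves : ∀ k x y → _∼_ (Q k) x y → _∼_ (Q' k) (collapse x) (collapse y)
  collapse-preserves k x y q =
    ∼-subst Q refl (sym (embed-collapse x)) (sym (embed-collapse y))
      (∼-trans (Q k) (rep∼ k x) (∼-trans (Q k) q (∼-sym (Q k) (rep∼ k y))))

  ⪯-reflect : ∀ k l → Q' k ⪯ Q' l → Q k ⪯ Q l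
  ⪯-reflect k l k⪯l x y q =
    collapse-reflects l x y (k⪯l (collapse x) (collapse y) (collapse-preserves k x y q))

-- Merging two unseparated states gives an equivalent device with one state
-- fewer and the "same" partitions, so antichains stay antichains.
mergeStates : (D : ASD) (s s' : Fin (states D)) → s ≢ s' → (∀ k → _∼_ (P D k) s s') →
  Σ ASD λ D' → (D' ≡ᴬ D) × (states D' < states D) × (Antichain D → Antichain D')
mergeStates record { states = zero } () s' s≢s' together
mergeStates D@record { states = suc m ; parts = p ; P = Q ; distinct = dist }
            s s' s≢s' together =
  D' , (into , back) , ≤-refl ,
  (λ anti k l k≢l k⪯l → anti k l k≢l (⪯-reflect k l k⪯l))
  where
  open Merge Q s s' s≢s' together
  D' : ASD
  D' = record
    { states = m ; parts = p ; P = Q'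
    ; distinct = λ k l k≢l (k⪯l , l⪯k) →
        dist k l k≢l (⪯-reflect k l k⪯l , ⪯-reflect l k l⪯k) }
  into : D' ≤ᴬ D
  into = embed , (λ k → k) , (λ k a b q → q)
  back : D ≤ᴬ D'
  back = collapse , (λ k → k) , collapse-reflects

separate : (D : ASD) (s s' : Fin (states D)) → ¬ (∀ k → _∼_ (P D k) s s') →
  Σ (Fin (parts D)) λ k → ¬ (_∼_ (P D k) s s')
separate D s s' = ¬∀⟶∃¬ (parts D) _ (λ k → ∼-dec (P D k) s s')

comparable-or-antichain : (D : ASD) →
  (Σ (Fin (parts D)) λ i → Σ (Fin (parts D)) λ j → (i ≢ j) × (P D i ⪯ P D j))
  ⊎ Antichain D
comparable-or-antichain D
  with any? (λ i → any? (λ j → ¬? (i ≟ᶠ j) ×-dec ⪯-dec (P D i) (P D j)))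
... | yes (i , j , i≢j , i⪯j) = inj₁ (i , j , i≢j , i⪯j)
... | no none = inj₂ (λ i j i≢j i⪯j → none (i , j , i≢j , i⪯j))

unseparated-or-separating : (D : ASD) →
  (Σ (Fin (states D)) λ s → Σ (Fin (states D)) λ s' →
     (s ≢ s') × (∀ k → _∼_ (P D k) s s'))
  ⊎ Separating D
unseparated-or-separating D
  with any? (λ s → any? (λ s' → ¬? (s ≟ᶠ s') ×-dec all? (λ k → ∼-dec (P D k) s s')))
... | yes (s , s' , s≢s' , together) = inj₁ (s , s' , s≢s' , together)
... | no none = inj₂ (λ s s' s≢s' → separate D s s' (λ together → none (s , s' , s≢s' , together)))

-- (i) State-minimality

separating⇒stateMinimal : ∀ D → Separating D → StateMinimal D
separating⇒stateMinimal D sep (D' , (_ , (φ , α , h)) , fewer)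
  with pigeonhole fewer φ
... | x , y , x<y , φx≡φy with sep x y (<⇒≢ x<y)
... | k , apart = apart (h k x y (∼-subst (P D') refl refl φx≡φy (∼-refl (P D' (α k)))))

stateMinimal⇒separating : ∀ D → StateMinimal D → Separating D
stateMinimal⇒separating D minimal s s' s≢s' = separate D s s' λ together →
  let (D' , D'≡D , fewer , _) = mergeStates D s s' s≢s' together
  in minimal (D' , D'≡D , fewer)

separating⇒meet≐id : ∀ D → Separating D → meet D ≐ idPart (states D)
separating⇒meet≐id D sep = meet⇒≡ , (λ { x .x refl k → ∼-refl (P D k) })
  where
  meet⇒≡ : ∀ x y → (∀ k → _∼_ (P D k) x y) → x ≡ y
  meet⇒≡ x y together with x ≟ᶠ y
  ... | yes x≡y = x≡y
  ... | no x≢y with sep x y x≢y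
  ...   | k , apart with apart (together k)
  ...     | ()

meet≐id⇒separating : ∀ D → meet D ≐ idPart (states D) → Separating D
meet≐id⇒separating D (meet⪯id , _) s s' s≢s' =
  separate D s s' (λ together → s≢s' (meet⪯id s s' together))

-- Idempotent powers of self-maps of finite sets

iterate-+ : ∀ {A : Set} (f : A → A) x m n →
  iterate f x (m + n) ≡ iterate f (iterate f x m) n
iterate-+ f x zero n = refl
iterate-+ f x (suc m) n = iterate-+ f (f x) m n

iterate-cong : ∀ {A : Set} (f : A → A) {x y} → f x ≡ f y → ∀ {k} → 1 ≤ k →
  iterate f x k ≡ iterate f y k
iterate-cong f fx≡fy {suc k} _ = cong (λ z → iterate f z k) fx≡fy

module EventuallyPeriodic {A : Set} (f : A → A) (x : A) {a d : ℕ}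
                          (cycle : iterate f x (a + d) ≡ iterate f x a) where
  open ≡-Reasoning

  shift : ∀ {s} → a ≤ s → iterate f x (d + s) ≡ iterate f x s
  shift {s} a≤s = begin
    iterate f x (d + s)                     ≡⟨ cong (iterate f x) arith ⟩
    iterate f x ((a + d) + (s ∸ a))         ≡⟨ iterate-+ f x (a + d) (s ∸ a) ⟩
    iterate f (iterate f x (a + d)) (s ∸ a) ≡⟨ cong (λ z → iterate f z (s ∸ a)) cycle ⟩
    iterate f (iterate f x a) (s ∸ a)       ≡⟨ iterate-+ f x a (s ∸ a) ⟨
    iterate f x (a + (s ∸ a))               ≡⟨ cong (iterate f x) (m+[n∸m]≡n a≤s) ⟩
    iterate f x s                           ∎
    where
    arith : d + s ≡ (a + d) + (s ∸ a)
    arith = begin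
      d + s               ≡⟨ cong (d +_) (m+[n∸m]≡n a≤s) ⟨
      d + (a + (s ∸ a))   ≡⟨ +-assoc d a (s ∸ a) ⟨
      (d + a) + (s ∸ a)   ≡⟨ cong (_+ (s ∸ a)) (+-comm d a) ⟩
      (a + d) + (s ∸ a)   ∎

  shift-multiple : ∀ q {s} → a ≤ s → iterate f x (q * d + s) ≡ iterate f x s
  shift-multiple zero a≤s = refl
  shift-multiple (suc q) {s} a≤s = begin
    iterate f x ((d + q * d) + s) ≡⟨ cong (iterate f x) (+-assoc d (q * d) s) ⟩
    iterate f x (d + (q * d + s)) ≡⟨ shift (≤-trans a≤s (m≤n+m s (q * d))) ⟩
    iterate f x (q * d + s)       ≡⟨ shift-multiple q a≤s ⟩
    iterate f x s                 ∎

  idempotent : ∀ {s} → a ≤ s → d ∣ s →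
    iterate f (iterate f x s) s ≡ iterate f x s
  idempotent {s} a≤s (divides q s≡qd) = begin
    iterate f (iterate f x s) s ≡⟨ iterate-+ f x s s ⟨
    iterate f x (s + s)         ≡⟨ cong (λ t → iterate f x (t + s)) s≡qd ⟩
    iterate f x (q * d + s)     ≡⟨ shift-multiple q a≤s ⟩
    iterate f x s               ∎

∣n! : ∀ {d n} → 1 ≤ d → d ≤ n → d ∣ n !
∣n! {suc d} _ d≤n = ∣-trans (m∣m*n (d !)) (m≤n⇒m!∣n! d≤n)

n≤n! : ∀ n → n ≤ n !
n≤n! zero = z≤n
n≤n! (suc n) = ∣⇒≤ {{suc n !≢0}} (∣n! (s≤s z≤n) ≤-refl)

-- For any self-map of an m-element set and any M ≥ m, f^(M !) is idempotent:
-- every orbit enters a cycle after fewer than m steps, of length at most m.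
iterate-idempotent : ∀ {m} (f : Fin m → Fin m) {M} → m ≤ M → ∀ x →
  iterate f (iterate f x (M !)) (M !) ≡ iterate f x (M !)
iterate-idempotent {m} f {M} m≤M x
  with pigeonhole (≤-refl {suc m}) (λ k → iterate f x (toℕ k))
... | i , j , i<j , fⁱ≡fʲ = idempotent (≤-trans a≤m m≤M!) (∣n! (m<n⇒0<n∸m i<j) d≤M)
  where
  a = toℕ i
  d = toℕ j ∸ toℕ i
  open EventuallyPeriodic f x {a} {d}
    (trans (cong (iterate f x) (m+[n∸m]≡n (≤-trans (n≤1+n a) i<j))) (sym fⁱ≡fʲ))
  a≤m : a ≤ m
  a≤m = toℕ≤pred[n] i
  m≤M! : m ≤ M !
  m≤M! = ≤-trans m≤M (n≤n! M)
  d≤M : d ≤ M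
  d≤M = ≤-trans (m∸n≤m (toℕ j) a) (≤-trans (toℕ≤pred[n] j) m≤M)

-- (ii) Partition-minimality

reduction-iterate : ∀ {D θ γ} → Reduction D D θ γ →
  ∀ k → Reduction D D (λ x → iterate θ x k) (λ a → iterate γ a k)
reduction-iterate h zero a x y q = q
reduction-iterate {D} h (suc k) = reduction-∘ {D} {D} {D} h (reduction-iterate {D} h k)

fixed-point-refines : ∀ {D τ δ} → Reduction D D τ δ → (∀ x → τ (τ x) ≡ τ x) →
  ∀ {c} → δ c ≡ c → ∀ {a} → δ a ≡ c → P D c ⪯ P D a
fixed-point-refines {D} {τ} h τ-idem {c} δc≡c {a} δa≡c x y x∼y =
  h a x y (∼-subst (P D) (sym δa≡c) refl refl
    (∼-trans (P D c) (∼-sym (P D c) (x∼τx x)) (∼-trans (P D c) x∼y (x∼τx y))))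
  where
  x∼τx : ∀ x → _∼_ (P D c) x (τ x)
  x∼τx x = h c x (τ x) (∼-subst (P D) (sym δc≡c) refl (sym (τ-idem x)) (∼-refl (P D c)))

-- In an antichain, every self-reduction is injective on partitions: with
-- N a common idempotent exponent, c = γ^N i satisfies γ^N c ≡ c, so P c
-- refines both P i and P j, forcing c ≡ i and c ≡ j.
antichain-self-reduction-injective : ∀ {D θ γ} → Antichain D → Reduction D D θ γ →
  ∀ {i j} → γ i ≡ γ j → i ≡ j
antichain-self-reduction-injective {D} {θ} {γ} anti h {i} {j} γi≡γj =
  trans (sym (c≡ i refl)) (c≡ j δj≡c)
  where
  N = (parts D + states D) !
  δ : Fin (parts D) → Fin (parts D)
  δ a = iterate γ a N
  c = δ i
  δc≡c : δ c ≡ c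
  δc≡c = iterate-idempotent γ (m≤m+n (parts D) (states D)) i
  δj≡c : δ j ≡ c
  δj≡c = iterate-cong γ (sym γi≡γj) (1≤n! (parts D + states D))
  c≡ : ∀ a → δ a ≡ c → c ≡ a
  c≡ a δa≡c with c ≟ᶠ a
  ... | yes c≡a = c≡a
  ... | no c≢a with anti c a c≢a
        (fixed-point-refines {D} (reduction-iterate {D} h N)
           (iterate-idempotent θ (m≤n+m (states D) (parts D))) δc≡c δa≡c)
  ...   | ()

-- A reduction to fewer partitions composes with its converse to a
-- self-reduction identifying two partitions, impossible in an antichain.
antichain⇒partitionMinimal : ∀ D → Antichain D → PartitionMinimal D
antichain⇒partitionMinimal D anti (D' , ((ψ , β , h₂) , (φ , α , h₁)) , fewer)
  with pigeonhole fewer α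
... | i , j , i<j , αi≡αj =
  <⇒≢ i<j (antichain-self-reduction-injective {D} anti
             (reduction-∘ {D} {D'} {D} h₁ h₂) (cong β αi≡αj))

partitionMinimal⇒antichain : ∀ D → PartitionMinimal D → Antichain D
partitionMinimal⇒antichain D minimal i j i≢j i⪯j = minimal (dropRefined D i j i≢j i⪯j)

-- (iii) Existence of minimal equivalents

module Descent (size : ASD → ℕ) (Inv Goal : ASD → Set)
  (step : ∀ D → Inv D → Goal D ⊎ (Σ ASD λ D' → (D' ≡ᴬ D) × (size D' < size D) × Inv D'))
  where

  descend-acc : ∀ D → Inv D → Acc _<_ (size D) → Σ ASD λ D' → (D' ≡ᴬ D) × Inv D' × Goal D'
  descend-acc D inv (acc smaller) with step D inv
  ... | inj₁ goal = D , ≡ᴬ-refl D , inv , goal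
  ... | inj₂ (D₁ , D₁≡D , fewer , inv₁) with descend-acc D₁ inv₁ (smaller fewer)
  ...   | D₂ , D₂≡D₁ , inv₂ , goal₂ =
    D₂ , ≡ᴬ-trans {D₂} {D₁} {D} D₂≡D₁ D₁≡D , inv₂ , goal₂

  descend : ∀ D → Inv D → Σ ASD λ D' → (D' ≡ᴬ D) × Inv D' × Goal D'
  descend D inv = descend-acc D inv (<-wellFounded (size D))

equivalent-antichain : ∀ D → Σ ASD λ D' → (D' ≡ᴬ D) × Antichain D'
equivalent-antichain D =
  let (D' , D'≡D , _ , anti) = descend D tt in D' , D'≡D , anti
  where
  dropStep : ∀ D → ⊤ →
    Antichain D ⊎ (Σ ASD λ D' → (D' ≡ᴬ D) × (parts D' < parts D) × ⊤)
  dropStep D _ with comparable-or-antichain D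
  ... | inj₂ anti = inj₁ anti
  ... | inj₁ (i , j , i≢j , i⪯j) with dropRefined D i j i≢j i⪯j
  ...   | D' , D'≡D , fewer = inj₂ (D' , D'≡D , fewer , tt)
  open Descent parts (λ _ → ⊤) Antichain dropStep

equivalent-separating-antichain : ∀ D → Antichain D →
  Σ ASD λ D' → (D' ≡ᴬ D) × Antichain D' × Separating D'
equivalent-separating-antichain = descend
  where
  mergeStep : ∀ D → Antichain D →
    Separating D ⊎ (Σ ASD λ D' → (D' ≡ᴬ D) × (states D' < states D) × Antichain D')
  mergeStep D anti with unseparated-or-separating D
  ... | inj₂ sep = inj₁ sep
  ... | inj₁ (s , s' , s≢s' , together) with mergeStates D s s' s≢s' together
  ...   | D' , D'≡D , fewer , keeps = inj₂ (D' , D'≡D , fewer , keeps anti)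
  open Descent states Antichain Separating mergeStep

theorem1 : ∀ (D : ASD) →
    ((StateMinimal D ⇔ Separating D) × (Separating D ⇔ (meet D ≐ idPart (states D))))
    × (PartitionMinimal D ⇔ Antichain D)
    × (Σ ASD λ D' → Minimal D' × (D' ≡ᴬ D))
theorem1 D =
  ( ( mk⇔ (stateMinimal⇒separating D) (separating⇒stateMinimal D)
    , mk⇔ (separating⇒meet≐id D) (meet≐id⇒separating D) )
  , mk⇔ (partitionMinimal⇒antichain D) (antichain⇒partitionMinimal D)
  , minimalEquivalent )
  where
  minimalEquivalent : Σ ASD λ D' → Minimal D' × (D' ≡ᴬ D)
  minimalEquivalent with equivalent-antichain D
  ... | D₁ , D₁≡D , anti₁ with equivalent-separating-antichain D₁ anti₁
  ...   | D₂ , D₂≡D₁ , anti₂ , sep₂ =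
    D₂ , (separating⇒stateMinimal D₂ sep₂ , antichain⇒partitionMinimal D₂ anti₂)
       , ≡ᴬ-trans {D₂} {D₁} {D} D₂≡D₁ D₁≡D
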